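{- Let $G=(V,E)$ be a graph with $V=\{1,2,\ldots,n\}$ and $|E|=m$, and let $f:V\to\mathbb{N}^+$ satisfy $\sum_{u\in V}f(u)=m+n$. Let $C_f$ denote the set of all proper colorings $c:V\to\{0,1,\ldots,\max\{f(i)-1:1\le i\le n\}\}$ of $G$. Then $G$ is $f$-AT if and only if $$\sum_{c\in C_f}(-1)^{\sum_{i=1}^n c(i)}\prod_{i=1}^n\binom{f(i)-1}{c(i)}P_G(c(1),\ldots,c(n))\neq 0.$$
   Context: The graph polynomial of $G$ is $P_G(x_1,\ldots,x_n)=\prod_{1\le i<j\le n,\ (i,j)\in E}(x_i-x_j)$ ($P_G\equiv1$ if $E=\emptyset$). For $f:V\to\mathbb{N}^+$, $G$ is called Alon-Tarsi $f$-choosable ($f$-AT) if the expansion of $P_G$ contains a monomial $c\prod_{i=1}^n x_i^{t_i}$ with real coefficient $c\neq0$ and $t_i\le f(i)-1$ for all $i$. A proper coloring assigns distinct colors to adjacent vertices. Binomial coefficients $\binom{a}{b}$ with $b>a$ are $0$. -}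

module Defs where

open import Data.Bool using (Bool; true; false; if_then_else_; not; _∧_) renaming (_≟_ to _≟ᵇ_)
open import Data.Nat as ℕ using (ℕ; zero; suc; _∸_; _⊔_; _≡ᵇ_; _<ᵇ_)
open import Data.Nat.Combinatorics using (_C_)
open import Data.Fin as Fin using (Fin; toℕ)
open import Data.Fin.Properties using () renaming (_≟_ to _≟ᶠ_)
open import Data.Integer as ℤ using (ℤ; +_; -[1+_])
open import Data.List as List using (List; []; _∷_; allFin; concatMap; map; filter; foldr; length)
open import Data.Product using (_×_; _,_)
open import Data.Vec.Functional using () renaming (_∷_ to _∷ᶠ_)
open import Relation.Nullary.Decidable using (⌊_⌋)
open import Relation.Binary.PropositionalEquality using (_≡_; _≢_)
open import Data.Nat.ListAction using (sum)
open import Data.Bool.ListAction using (and)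
open import Data.Product using (Σ)

-- A finite simple graph on the vertex set Fin n (vertices 1..n of the paper
-- are 0..n-1 here), given by a Boolean adjacency relation that is symmetric
-- and irreflexive.
record Graph (n : ℕ) : Set where
  field
    adj   : Fin n → Fin n → Bool
    sym   : ∀ i j → adj i j ≡ adj j i
    irrefl : ∀ i → adj i i ≡ false

open Graph public

edges : ∀ {n} → Graph n → List (Fin n × Fin n)
edges {n} G =
  concatMap (λ i → map (λ j → (i , j))
    (filter (λ j → _≟ᵇ_ ((toℕ i <ᵇ toℕ j) ∧ adj G i j) true) (allFin n)))
    (allFin n)

numEdges : ∀ {n} → Graph n → ℕ
numEdges G = length (edges G)

sumV : ∀ {n} → (Fin n → ℕ) → ℕ
sumV {n} f = sum (map f (allFin n))

sumℤ : ∀ {A : Set} → List A → (A → ℤ) → ℤ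
sumℤ xs g = foldr (λ x acc → g x ℤ.+ acc) (+ 0) xs

prodℤ : ∀ {A : Set} → List A → (A → ℤ) → ℤ
prodℤ xs g = foldr (λ x acc → g x ℤ.* acc) (+ 1) xs

-- Coefficients of the expansion of a product of linear factors (x_i - x_j).
-- A monomial Π x_i^{t_i} is represented by its exponent vector t.

lowerAt : ∀ {n} → Fin n → (Fin n → ℕ) → (Fin n → ℕ)
lowerAt i t k = if ⌊ k ≟ᶠ i ⌋ then t k ∸ 1 else t k

-- coefficient of x^t in Π_{(i,j) ∈ es} (x_i - x_j).
-- For the empty product this is 1 at t = 0 and 0 otherwise; for
-- (x_i - x_j) · Q the coefficient of x^t is
--   [t_i ≥ 1] coeff_Q(t - e_i)  -  [t_j ≥ 1] coeff_Q(t - e_j).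
coeffProd : ∀ {n} → List (Fin n × Fin n) → (Fin n → ℕ) → ℤ
coeffProd {n} [] t =
  if and (map (λ k → t k ≡ᵇ 0) (allFin n)) then + 1 else + 0
coeffProd ((i , j) ∷ es) t = termAt i ℤ.- termAt j
  where
    termAt : _ → ℤ
    termAt k with t k
    ... | zero  = + 0
    ... | suc _ = coeffProd es (lowerAt k t)

coeffPG : ∀ {n} → Graph n → (Fin n → ℕ) → ℤ
coeffPG G t = coeffProd (edges G) t

AT : ∀ {n} → Graph n → (Fin n → ℕ) → Set
AT {n} G f = Σ (Fin n → ℕ) λ t →
  ((i : Fin n) → t i ℕ.≤ f i ∸ 1) × (coeffPG G t ≢ + 0)

evalPG : ∀ {n} → Graph n → (Fin n → ℕ) → ℤ
evalPG G a = prodℤ (edges G) (λ { (i , j) → + a i ℤ.- + a j })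

allFuns : (n k : ℕ) → List (Fin n → Fin k)
allFuns zero    k = (λ ()) ∷ []
allFuns (suc n) k =
  concatMap (λ a → map (λ g → a ∷ᶠ g) (allFuns n k)) (allFin k)

isProper : ∀ {n k} → Graph n → (Fin n → Fin k) → Bool
isProper G c =
  and (map (λ { (i , j) → not (toℕ (c i) ≡ᵇ toℕ (c j)) }) (edges G))

maxDeg : ∀ {n} → (Fin n → ℕ) → ℕ
maxDeg {n} f = foldr (λ i acc → (f i ∸ 1) ⊔ acc) 0 (allFin n)

Cf : ∀ {n} → Graph n → (f : Fin n → ℕ) → List (Fin n → Fin (suc (maxDeg f)))
Cf {n} G f = filter (λ c → _≟ᵇ_ (isProper G c) true) (allFuns n (suc (maxDeg f)))

signℤ : ℕ → ℤ
signℤ zero    = + 1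
signℤ (suc k) = ℤ.- signℤ k

colorSum : ∀ {n} → Graph n → (Fin n → ℕ) → ℤ
colorSum {n} G f = sumℤ (Cf G f) λ c →
  let a = λ i → toℕ (c i) in
  signℤ (sum (map a (allFin n)))
  ℤ.* prodℤ (allFin n) (λ i → + ((f i ∸ 1) C a i))
  ℤ.* evalPG G a

-- Put d = f - 1, so that Σ d = |E|, and let the colours range over K > max d. Weighting a colouring a
-- by w_d(a) = Π_i (-1)^{a_i} C(d_i, a_i), the weighted sum of a product of linear forms x_i - x_j
-- equals Π_i (-1)^{d_i} d_i! times its coefficient of x^d (a form of the Combinatorial
-- Nullstellensatz). This is proved by induction on the list of factors: the identity
-- a C(d, a) = d (C(d, a) - C(d - 1, a)) trades a factor x_i for lowering d_i, terms of too low
-- degree vanish by homogeneity, and the base case is Σ_{a < K} (-1)^a C(d, a) = [d = 0].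
-- Improper colourings contribute nothing, so the colouring sum is a nonzero multiple of [x^d] P_G.
-- Finally, P_G is homogeneous of degree |E| = Σ d, so a monomial x^t with t ≤ d occurs in P_G only
-- if t = d; hence G is f-AT iff [x^d] P_G ≠ 0.

module Submission where

open import Algebra.Bundles using (CommutativeMonoid)
open import Data.Bool using (Bool; true; false; if_then_else_; not; _∧_; T) renaming (_≟_ to _≟ᵇ_)
open import Data.Bool.ListAction using (and)
open import Data.Bool.Properties using (not-injective)
open import Data.Empty using (⊥-elim)
open import Data.Fin using (Fin; zero; suc; toℕ)
open import Data.Fin.Properties using (punchInᵢ≢i; toℕ-inject₁; toℕ-fromℕ) renaming (_≟_ to _≟ᶠ_)
open import Data.Integer using (ℤ; +_)
import Data.Integer.Properties as ℤP
open import Data.List as List using (List; []; _∷_; allFin; map; filter; length; tabulate; concatMap; _++_)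
open import Data.List.Membership.Propositional using (_∈_)
open import Data.List.Membership.Propositional.Properties using (∈-allFin)
open import Data.List.Properties using (map-tabulate; foldr-map)
open import Data.List.Relation.Unary.Any using (here; there)
open import Data.Nat using (ℕ; zero; suc; _∸_; _≤_; _<_; _≥_; _!; _≡ᵇ_; _⊔_; s≤s)
import Data.Nat.Properties as ℕP
open import Data.Nat.Combinatorics using (_C_; nCk+nC[k+1]≡[n+1]C[k+1]; k>n⇒nCk≡0)
open import Data.Product using (_×_; _,_; ∃-syntax)
open import Data.Sum using ([_,_]′)
open import Data.Unit using (tt)
open import Data.Vec.Functional as Vector using (Vector; removeAt) renaming (_∷_ to _∷ᶠ_)
open import Function using (_∘_; id; _⇔_; mk⇔)
open import Function.Construct.Composition using (_⇔-∘_)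
open import Relation.Binary.PropositionalEquality
open import Relation.Nullary.Decidable using (⌊_⌋; yes; no; decidable-stable)
open import Defs hiding (sym)

open import Algebra.Properties.CommutativeMonoid.Sum ℕP.+-0-commutativeMonoid
  using (∑-distrib-+) renaming (sum to ∑; sum-cong-≗ to ∑-cong)
open import Algebra.Properties.CommutativeMonoid.Sum ℤP.+-0-commutativeMonoid
  using () renaming (sum to ∑ℤ; sum-cong-≗ to ∑ℤ-cong; sum-init-last to ∑ℤ-init-last)
open import Algebra.Properties.CommutativeMonoid.Sum ℤP.*-1-commutativeMonoid
  using () renaming (sum to ∏; sum-cong-≗ to ∏-cong; ∑-distrib-+ to ∏-distrib-*)

foldr-tabulate : ∀ {A B : Set} (_∙_ : A → B → B) (e : B) {n} (g : Fin n → A) →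
                 List.foldr _∙_ e (tabulate g) ≡ Vector.foldr _∙_ e g
foldr-tabulate _∙_ e {zero}  g = refl
foldr-tabulate _∙_ e {suc n} g = cong (g zero ∙_) (foldr-tabulate _∙_ e (g ∘ suc))

foldr-map-allFin : ∀ {A B : Set} (_∙_ : A → B → B) (e : B) {n} (g : Fin n → A) →
                   List.foldr _∙_ e (map g (allFin n)) ≡ Vector.foldr _∙_ e g
foldr-map-allFin _∙_ e g =
  trans (cong (List.foldr _∙_ e) (map-tabulate id g)) (foldr-tabulate _∙_ e g)

foldr-homomorphic : ∀ {A B : Set} (h : A → B) {_∙_ : A → A → A} {_◦_ : B → B → B} {e : A} {e′ : B} →
                    h e ≡ e′ → (∀ x y → h (x ∙ y) ≡ h x ◦ h y) →
                    ∀ {n} (v : Vector A n) → h (Vector.foldr _∙_ e v) ≡ Vector.foldr _◦_ e′ (h ∘ v)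
foldr-homomorphic h h-e h-∙ {zero}  v = h-e
foldr-homomorphic h {_◦_ = _◦_} h-e h-∙ {suc n} v =
  trans (h-∙ (v zero) _) (cong (h (v zero) ◦_) (foldr-homomorphic h h-e h-∙ (v ∘ suc)))

≤-foldr-⊔ : ∀ {A : Set} (g : A → ℕ) {x xs} → x ∈ xs → g x ≤ List.foldr (λ y acc → g y ⊔ acc) 0 xs
≤-foldr-⊔ g (here refl) = ℕP.m≤m⊔n (g _) _
≤-foldr-⊔ g {xs = y ∷ _} (there x∈xs) = ℕP.m≤n⇒m≤o⊔n (g y) (≤-foldr-⊔ g x∈xs)

lowerAt-self : ∀ {n} (i : Fin n) t → lowerAt i t i ≡ t i ∸ 1
lowerAt-self i t with i ≟ᶠ i
... | yes _   = refl
... | no i≢i  = ⊥-elim (i≢i refl)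

lowerAt-other : ∀ {n} {i k : Fin n} t → k ≢ i → lowerAt i t k ≡ t k
lowerAt-other {i = i} {k} t k≢i with k ≟ᶠ i
... | yes k≡i = ⊥-elim (k≢i k≡i)
... | no _    = refl

lowerAt-≤ : ∀ {n} (i : Fin n) t k → lowerAt i t k ≤ t k
lowerAt-≤ i t k with k ≟ᶠ i
... | yes _ = ℕP.m∸n≤m (t k) 1
... | no _  = ℕP.≤-refl

lowerAt-cong : ∀ {n} (i : Fin n) {t u} → t ≗ u → lowerAt i t ≗ lowerAt i u
lowerAt-cong i t≗u k = cong (λ x → if ⌊ k ≟ᶠ i ⌋ then x ∸ 1 else x) (t≗u k)

module _ {c ℓ} (M : CommutativeMonoid c ℓ) where
  open CommutativeMonoid M using (Carrier; _≈_; _∙_; ∙-congˡ; reflexive)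
    renaming (trans to ≈-trans; sym to ≈-sym)
  open import Algebra.Properties.CommutativeMonoid.Sum M using (sum; sum-remove; sum-cong-≋)

  sum-agreeing-off : ∀ {n} (i : Fin n) {t u : Vector Carrier n} → (∀ k → k ≢ i → t k ≈ u k) →
                     ∃[ r ] (sum t ≈ t i ∙ r × sum u ≈ u i ∙ r)
  sum-agreeing-off {suc n} i {t} {u} t≈u =
    sum (removeAt t i) , sum-remove t ,
    ≈-trans (sum-remove u) (∙-congˡ (sum-cong-≋ λ k → ≈-sym (t≈u _ (punchInᵢ≢i i k))))

  sum-lowerAt : ∀ {n} (φ : Fin n → ℕ → Carrier) (i : Fin n) (d : Fin n → ℕ) →
                ∃[ r ] (sum (λ k → φ k (d k)) ≈ φ i (d i) ∙ r ×
                        sum (λ k → φ k (lowerAt i d k)) ≈ φ i (d i ∸ 1) ∙ r)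
  sum-lowerAt φ i d with sum-agreeing-off i (λ k k≢i → reflexive (cong (φ k) (sym (lowerAt-other d k≢i))))
  ... | r , ∑φd≈ , ∑φd′≈ =
    r , ∑φd≈ , ≈-trans ∑φd′≈ (reflexive (cong (λ x → φ i x ∙ r) (lowerAt-self i d)))

module BinomialCoefficients where
  open import Data.Nat using (_+_; _*_)
  open ≡-Reasoning

  nC0≡1 : ∀ n → n C 0 ≡ 1
  nC0≡1 zero    = refl
  nC0≡1 (suc n) = refl

  [1+k]*[1+n]C[1+k]≡[1+n]*nCk : ∀ n k → suc k * (suc n C suc k) ≡ suc n * (n C k)
  [1+k]*[1+n]C[1+k]≡[1+n]*nCk zero    zero    = refl
  [1+k]*[1+n]C[1+k]≡[1+n]*nCk zero    (suc k) = ℕP.*-zeroʳ (suc (suc k))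
  [1+k]*[1+n]C[1+k]≡[1+n]*nCk (suc n) zero    = begin
    1 * (suc (suc n) C 1)      ≡⟨ ℕP.*-identityˡ _ ⟩
    suc (suc n) C 1            ≡⟨ nCk+nC[k+1]≡[n+1]C[k+1] (suc n) 0 ⟨
    suc n C 0 + suc n C 1      ≡⟨ cong₂ _+_ (nC0≡1 (suc n)) (sym (ℕP.*-identityˡ _)) ⟩
    1 + 1 * (suc n C 1)        ≡⟨ cong suc ([1+k]*[1+n]C[1+k]≡[1+n]*nCk n 0) ⟩
    1 + suc n * (n C 0)        ≡⟨ cong (λ x → 1 + suc n * x) (nC0≡1 n) ⟩
    suc (suc n) * 1            ≡⟨ cong (suc (suc n) *_) (sym (nC0≡1 (suc n))) ⟩
    suc (suc n) * (suc n C 0)  ∎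
  [1+k]*[1+n]C[1+k]≡[1+n]*nCk (suc n) (suc k) = begin
    suc (suc k) * (suc (suc n) C suc (suc k))
      ≡⟨ cong (suc (suc k) *_) (nCk+nC[k+1]≡[n+1]C[k+1] (suc n) (suc k)) ⟨
    suc (suc k) * (suc n C suc k + suc n C suc (suc k))
      ≡⟨ ℕP.*-distribˡ-+ (suc (suc k)) (suc n C suc k) (suc n C suc (suc k)) ⟩
    suc n C suc k + suc k * (suc n C suc k) + suc (suc k) * (suc n C suc (suc k))
      ≡⟨ cong₂ (λ x y → suc n C suc k + x + y) ([1+k]*[1+n]C[1+k]≡[1+n]*nCk n k)
                                                 ([1+k]*[1+n]C[1+k]≡[1+n]*nCk n (suc k)) ⟩
    suc n C suc k + suc n * (n C k) + suc n * (n C suc k)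
      ≡⟨ ℕP.+-assoc (suc n C suc k) (suc n * (n C k)) (suc n * (n C suc k)) ⟩
    suc n C suc k + (suc n * (n C k) + suc n * (n C suc k))
      ≡⟨ cong (_+_ (suc n C suc k)) (sym (ℕP.*-distribˡ-+ (suc n) (n C k) (n C suc k))) ⟩
    suc n C suc k + suc n * (n C k + n C suc k)
      ≡⟨ cong (λ x → suc n C suc k + suc n * x) (nCk+nC[k+1]≡[n+1]C[k+1] n k) ⟩
    suc (suc n) * (suc n C suc k)
      ∎

  k*nCk+n*[n∸1]Ck≡n*nCk : ∀ n k → k * (n C k) + n * ((n ∸ 1) C k) ≡ n * (n C k)
  k*nCk+n*[n∸1]Ck≡n*nCk zero    zero    = refl
  k*nCk+n*[n∸1]Ck≡n*nCk zero    (suc k) = cong (_+ 0) (ℕP.*-zeroʳ (suc k))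
  k*nCk+n*[n∸1]Ck≡n*nCk (suc n) zero    = cong (suc n *_) (trans (nC0≡1 n) (sym (nC0≡1 (suc n))))
  k*nCk+n*[n∸1]Ck≡n*nCk (suc n) (suc k) = begin
    suc k * (suc n C suc k) + suc n * (n C suc k)
      ≡⟨ cong (_+ suc n * (n C suc k)) ([1+k]*[1+n]C[1+k]≡[1+n]*nCk n k) ⟩
    suc n * (n C k) + suc n * (n C suc k)
      ≡⟨ sym (ℕP.*-distribˡ-+ (suc n) (n C k) (n C suc k)) ⟩
    suc n * (n C k + n C suc k)
      ≡⟨ cong (suc n *_) (nCk+nC[k+1]≡[n+1]C[k+1] n k) ⟩
    suc n * (suc n C suc k)
      ∎

open BinomialCoefficients

module NatSums where
  open import Data.Nat using (_+_)
  open ≡-Reasoning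

  sumV≡∑ : ∀ {n} (t : Fin n → ℕ) → sumV t ≡ ∑ t
  sumV≡∑ t = foldr-map-allFin _+_ 0 t

  ∑-lowerAt : ∀ {n} (i : Fin n) t {p} → t i ≡ suc p → ∑ t ≡ suc (∑ (lowerAt i t))
  ∑-lowerAt i t {p} tᵢ≡1+p with sum-lowerAt ℕP.+-0-commutativeMonoid (λ _ x → x) i t
  ... | r , ∑t≡ , ∑t′≡ = begin
    ∑ t                     ≡⟨ ∑t≡ ⟩
    t i + r                 ≡⟨ cong (_+ r) tᵢ≡1+p ⟩
    suc (p + r)             ≡⟨ cong (λ x → suc (x ∸ 1 + r)) tᵢ≡1+p ⟨
    suc (t i ∸ 1 + r)       ≡⟨ cong suc ∑t′≡ ⟨
    suc (∑ (lowerAt i t))   ∎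

  ∑-const-1 : ∀ n → ∑ {n} (λ _ → 1) ≡ n
  ∑-const-1 zero    = refl
  ∑-const-1 (suc n) = cong suc (∑-const-1 n)

  ∑-pred : ∀ {n} (f : Fin n → ℕ) → (∀ i → f i ≥ 1) → ∑ f ≡ ∑ (λ i → f i ∸ 1) + n
  ∑-pred {n} f f≥1 = begin
    ∑ f                                  ≡⟨ ∑-cong (λ i → sym (ℕP.m∸n+n≡m (f≥1 i))) ⟩
    ∑ (λ i → f i ∸ 1 + 1)                ≡⟨ ∑-distrib-+ (λ i → f i ∸ 1) (λ _ → 1) ⟩
    ∑ (λ i → f i ∸ 1) + ∑ {n} (λ _ → 1)  ≡⟨ cong (_+_ (∑ (λ i → f i ∸ 1))) (∑-const-1 n) ⟩
    ∑ (λ i → f i ∸ 1) + n                ∎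

  ∑≡0⇒≡0 : ∀ {n} (u : Fin n → ℕ) → ∑ u ≡ 0 → ∀ k → u k ≡ 0
  ∑≡0⇒≡0 u ∑u≡0 k with sum-agreeing-off ℕP.+-0-commutativeMonoid k {u} {u} (λ _ _ → refl)
  ... | r , ∑u≡ , _ = ℕP.m+n≡0⇒m≡0 (u k) (trans (sym ∑u≡) ∑u≡0)

  ≤∧∑≡⇒≗ : ∀ {n} {t d : Fin n → ℕ} → (∀ k → t k ≤ d k) → ∑ t ≡ ∑ d → t ≗ d
  ≤∧∑≡⇒≗ {t = t} {d} t≤d ∑t≡∑d k =
    ℕP.≤-antisym (t≤d k) (ℕP.m∸n≡0⇒m≤n (∑≡0⇒≡0 (λ k → d k ∸ t k) ∑gap≡0 k))
    where
      ∑gap≡0 : ∑ (λ k → d k ∸ t k) ≡ 0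
      ∑gap≡0 = ℕP.+-cancelˡ-≡ (∑ t) _ _ (begin
        ∑ t + ∑ (λ k → d k ∸ t k)  ≡⟨ ∑-distrib-+ t (λ k → d k ∸ t k) ⟨
        ∑ (λ k → t k + (d k ∸ t k)) ≡⟨ ∑-cong (λ k → ℕP.m+[n∸m]≡n (t≤d k)) ⟩
        ∑ d                         ≡⟨ ∑t≡∑d ⟨
        ∑ t                         ≡⟨ ℕP.+-identityʳ (∑ t) ⟨
        ∑ t + 0                     ∎)
    
open NatSums

module IntegerSums where
  open import Data.Integer using (_+_; _*_; _-_)
  open import Data.Integer.Tactic.RingSolver using (solve-∀)
  open ≡-Reasoning

  *-≢0 : ∀ {x y : ℤ} → x ≢ + 0 → y ≢ + 0 → x * y ≢ + 0
  *-≢0 {x} x≢0 y≢0 = [ x≢0 , y≢0 ]′ ∘ ℤP.i*j≡0⇒i≡0∨j≡0 x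

  ∏-≢0 : ∀ {n} (h : Fin n → ℤ) → (∀ k → h k ≢ + 0) → ∏ h ≢ + 0
  ∏-≢0 {zero}  h h≢0 ()
  ∏-≢0 {suc n} h h≢0 = *-≢0 (h≢0 zero) (∏-≢0 (h ∘ suc) (h≢0 ∘ suc))

  prodℤ-allFin : ∀ {n} (h : Fin n → ℤ) → prodℤ (allFin n) h ≡ ∏ h
  prodℤ-allFin {n} h = trans (sym (foldr-map _*_ h (+ 1) (allFin n))) (foldr-map-allFin _*_ (+ 1) h)

  sumℤ-allFin : ∀ {n} (h : Fin n → ℤ) → sumℤ (allFin n) h ≡ ∑ℤ h
  sumℤ-allFin {n} h = trans (sym (foldr-map _+_ h (+ 0) (allFin n))) (foldr-map-allFin _+_ (+ 0) h)

  sumℤ-cong : ∀ {A : Set} (xs : List A) {u v : A → ℤ} → (∀ x → u x ≡ v x) → sumℤ xs u ≡ sumℤ xs v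
  sumℤ-cong []       u≡v = refl
  sumℤ-cong (x ∷ xs) u≡v = cong₂ _+_ (u≡v x) (sumℤ-cong xs u≡v)

  sumℤ-distrib-minus : ∀ {A : Set} (xs : List A) (u v : A → ℤ) →
                   sumℤ xs (λ x → u x - v x) ≡ sumℤ xs u - sumℤ xs v
  sumℤ-distrib-minus []       u v = refl
  sumℤ-distrib-minus (x ∷ xs) u v =
    trans (cong (_+_ (u x - v x)) (sumℤ-distrib-minus xs u v)) (interchange (u x) (v x) _ _)
    where
      interchange : ∀ (a b c d : ℤ) → (a - b) + (c - d) ≡ (a + c) - (b + d)
      interchange = solve-∀

  sumℤ-*ˡ : ∀ {A : Set} (xs : List A) (k : ℤ) (u : A → ℤ) → sumℤ xs (λ x → k * u x) ≡ k * sumℤ xs u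
  sumℤ-*ˡ []       k u = sym (ℤP.*-zeroʳ k)
  sumℤ-*ˡ (x ∷ xs) k u = trans (cong (_+_ (k * u x)) (sumℤ-*ˡ xs k u)) (sym (ℤP.*-distribˡ-+ k (u x) _))

  sumℤ-*ʳ : ∀ {A : Set} (xs : List A) (k : ℤ) (u : A → ℤ) → sumℤ xs (λ x → u x * k) ≡ sumℤ xs u * k
  sumℤ-*ʳ []       k u = sym (ℤP.*-zeroˡ k)
  sumℤ-*ʳ (x ∷ xs) k u = trans (cong (_+_ (u x * k)) (sumℤ-*ʳ xs k u)) (sym (ℤP.*-distribʳ-+ k (u x) _))

  sumℤ-++ : ∀ {A : Set} (xs ys : List A) (u : A → ℤ) → sumℤ (xs ++ ys) u ≡ sumℤ xs u + sumℤ ys u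
  sumℤ-++ []       ys u = sym (ℤP.+-identityˡ _)
  sumℤ-++ (x ∷ xs) ys u = trans (cong (_+_ (u x)) (sumℤ-++ xs ys u)) (sym (ℤP.+-assoc (u x) _ _))

  sumℤ-concatMap : ∀ {A B : Set} (f : A → List B) (xs : List A) (u : B → ℤ) →
                   sumℤ (concatMap f xs) u ≡ sumℤ xs (λ x → sumℤ (f x) u)
  sumℤ-concatMap f []       u = refl
  sumℤ-concatMap f (x ∷ xs) u =
    trans (sumℤ-++ (f x) (concatMap f xs) u) (cong (_+_ (sumℤ (f x) u)) (sumℤ-concatMap f xs u))

  sumℤ-map : ∀ {A B : Set} (f : A → B) (xs : List A) (u : B → ℤ) → sumℤ (map f xs) u ≡ sumℤ xs (u ∘ f)
  sumℤ-map f []       u = refl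
  sumℤ-map f (x ∷ xs) u = cong (_+_ (u (f x))) (sumℤ-map f xs u)

  sumℤ-filter : ∀ {A : Set} (p : A → Bool) (xs : List A) (u : A → ℤ) →
                (∀ x → p x ≡ false → u x ≡ + 0) →
                sumℤ (filter (λ x → p x ≟ᵇ true) xs) u ≡ sumℤ xs u
  sumℤ-filter p []       u u≡0 = refl
  sumℤ-filter p (x ∷ xs) u u≡0 with p x in px
  ... | true  = cong (_+_ (u x)) (sumℤ-filter p xs u u≡0)
  ... | false = begin
    sumℤ (filter (λ x → p x ≟ᵇ true) xs) u  ≡⟨ sumℤ-filter p xs u u≡0 ⟩
    sumℤ xs u                               ≡⟨ ℤP.+-identityˡ (sumℤ xs u) ⟨
    + 0 + sumℤ xs u                         ≡⟨ cong (_+ sumℤ xs u) (u≡0 x px) ⟨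
    u x + sumℤ xs u                         ∎

  prodℤ-vanishing : ∀ {A : Set} (p : A → Bool) (xs : List A) (u : A → ℤ) →
                    (∀ x → p x ≡ false → u x ≡ + 0) →
                    and (map p xs) ≡ false → prodℤ xs u ≡ + 0
  prodℤ-vanishing p (x ∷ xs) u u≡0 ∧p≡false with p x in px
  ... | true  = trans (cong (u x *_) (prodℤ-vanishing p xs u u≡0 ∧p≡false)) (ℤP.*-zeroʳ (u x))
  ... | false = trans (cong (_* prodℤ xs u) (u≡0 x px)) (ℤP.*-zeroˡ (prodℤ xs u))

  sumℤ-allFuns : ∀ n K (g : Fin n → Fin K → ℤ) →
                 sumℤ (allFuns n K) (λ c → ∏ (λ k → g k (c k))) ≡ ∏ (λ k → sumℤ (allFin K) (g k))
  sumℤ-allFuns zero    K g = refl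
  sumℤ-allFuns (suc n) K g = begin
    sumℤ (concatMap (λ a → map (a ∷ᶠ_) (allFuns n K)) (allFin K)) P
      ≡⟨ sumℤ-concatMap (λ a → map (a ∷ᶠ_) (allFuns n K)) (allFin K) P ⟩
    sumℤ (allFin K) (λ a → sumℤ (map (a ∷ᶠ_) (allFuns n K)) P)
      ≡⟨ sumℤ-cong (allFin K) (λ a → sumℤ-map (a ∷ᶠ_) (allFuns n K) P) ⟩
    sumℤ (allFin K) (λ a → sumℤ (allFuns n K) (λ c → g zero a * ∏ (λ k → g (suc k) (c k))))
      ≡⟨ sumℤ-cong (allFin K) (λ a → sumℤ-*ˡ (allFuns n K) (g zero a) _) ⟩
    sumℤ (allFin K) (λ a → g zero a * sumℤ (allFuns n K) (λ c → ∏ (λ k → g (suc k) (c k))))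
      ≡⟨ sumℤ-cong (allFin K) (λ a → cong (g zero a *_) (sumℤ-allFuns n K (g ∘ suc))) ⟩
    sumℤ (allFin K) (λ a → g zero a * ∏ (λ k → sumℤ (allFin K) (g (suc k))))
      ≡⟨ sumℤ-*ʳ (allFin K) _ (g zero) ⟩
    sumℤ (allFin K) (g zero) * ∏ (λ k → sumℤ (allFin K) (g (suc k)))
      ∎
    where
      P : (Fin (suc n) → Fin K) → ℤ
      P c = ∏ (λ k → g k (c k))

  ∑ℤ-snoc : ∀ K (φ : ℕ → ℤ) →
            ∑ℤ (λ (a : Fin (suc K)) → φ (toℕ a)) ≡ ∑ℤ (λ (a : Fin K) → φ (toℕ a)) + φ K
  ∑ℤ-snoc K φ = trans (∑ℤ-init-last {K} (φ ∘ toℕ))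
                      (cong₂ _+_ (∑ℤ-cong {K} (cong φ ∘ toℕ-inject₁)) (cong φ (toℕ-fromℕ K)))

open IntegerSums

module CoefficientFormula where
  import Data.Nat as Nat
  open import Data.Integer using (_+_; _*_; _-_; -_; ∣_∣)
  open import Data.Integer.Tactic.RingSolver using (solve-∀)
  open ≡-Reasoning

  signℤ-+ : ∀ m n → signℤ (m Nat.+ n) ≡ signℤ m * signℤ n
  signℤ-+ zero    n = sym (ℤP.*-identityˡ (signℤ n))
  signℤ-+ (suc m) n = trans (cong -_ (signℤ-+ m n)) (ℤP.neg-distribˡ-* (signℤ m) (signℤ n))

  δ₀ : ℕ → ℤ
  δ₀ zero    = + 1
  δ₀ (suc _) = + 0

  δ₀-+ : ∀ m n → δ₀ (m Nat.+ n) ≡ δ₀ m * δ₀ n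
  δ₀-+ zero    n = sym (ℤP.*-identityˡ (δ₀ n))
  δ₀-+ (suc m) n = sym (ℤP.*-zeroˡ (δ₀ n))

  δ₀-∑ : ∀ {n} (t : Fin n → ℕ) → δ₀ (∑ t) ≡ ∏ (δ₀ ∘ t)
  δ₀-∑ = foldr-homomorphic δ₀ refl δ₀-+

  signedFactorial : ℕ → ℤ
  signedFactorial d = signℤ d * + (d !)

  signedFactorial-suc : ∀ d → signedFactorial (suc d) ≡ - (+ suc d * signedFactorial d)
  signedFactorial-suc d = begin
    signedFactorial (suc d)            ≡⟨⟩
    - signℤ d * + (suc d Nat.* d !)    ≡⟨ cong (- signℤ d *_) (ℤP.pos-* (suc d) (d !)) ⟩
    - signℤ d * (+ suc d * + (d !))    ≡⟨ rearrange (signℤ d) (+ suc d) (+ (d !)) ⟩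
    - (+ suc d * signedFactorial d)    ∎
    where
      rearrange : ∀ (s m f : ℤ) → - s * (m * f) ≡ - (m * (s * f))
      rearrange = solve-∀

  ∣signedFactorial∣ : ∀ d → ∣ signedFactorial d ∣ ≡ d !
  ∣signedFactorial∣ zero    = refl
  ∣signedFactorial∣ (suc d) = begin
    ∣ signedFactorial (suc d) ∣          ≡⟨ cong ∣_∣ (signedFactorial-suc d) ⟩
    ∣ - (+ suc d * signedFactorial d) ∣  ≡⟨ ℤP.∣-i∣≡∣i∣ (+ suc d * signedFactorial d) ⟩
    ∣ + suc d * signedFactorial d ∣      ≡⟨ ℤP.abs-* (+ suc d) (signedFactorial d) ⟩
    suc d Nat.* ∣ signedFactorial d ∣    ≡⟨ cong (suc d Nat.*_) (∣signedFactorial∣ d) ⟩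
    suc d !                              ∎

  signedFactorial≢0 : ∀ d → signedFactorial d ≢ + 0
  signedFactorial≢0 d sd≡0 =
    Nat.≢-nonZero⁻¹ (d !) {{d ℕP.!≢0}} (trans (sym (∣signedFactorial∣ d)) (cong ∣_∣ sd≡0))

  δ₀≡signedFactorial*δ₀ : ∀ d → δ₀ d ≡ signedFactorial d * δ₀ d
  δ₀≡signedFactorial*δ₀ zero    = refl
  δ₀≡signedFactorial*δ₀ (suc d) = sym (ℤP.*-zeroʳ (signedFactorial (suc d)))

  signedFactorials : ∀ {n} → (Fin n → ℕ) → ℤ
  signedFactorials d = ∏ (signedFactorial ∘ d)

  signedFactorials≢0 : ∀ {n} (d : Fin n → ℕ) → signedFactorials d ≢ + 0
  signedFactorials≢0 d = ∏-≢0 (signedFactorial ∘ d) (signedFactorial≢0 ∘ d)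

  binomialWeight : ℕ → ℕ → ℤ
  binomialWeight d a = signℤ a * + (d C a)

  alternatingSum-0 : ∀ K → ∑ℤ (λ (a : Fin (suc K)) → binomialWeight 0 (toℕ a)) ≡ + 1
  alternatingSum-0 zero    = refl
  alternatingSum-0 (suc K) = begin
    ∑ℤ (λ (a : Fin (suc (suc K))) → binomialWeight 0 (toℕ a))
      ≡⟨ ∑ℤ-snoc (suc K) (binomialWeight 0) ⟩
    ∑ℤ (λ (a : Fin (suc K)) → binomialWeight 0 (toℕ a)) + signℤ (suc K) * + 0
      ≡⟨ cong₂ _+_ (alternatingSum-0 K) (ℤP.*-zeroʳ (signℤ (suc K))) ⟩
    + 1
      ∎

  alternatingSum-partial : ∀ d K →
                           ∑ℤ (λ (a : Fin (suc K)) → binomialWeight (suc d) (toℕ a)) ≡ signℤ K * + (d C K)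
  alternatingSum-partial d zero    = cong (λ x → + 1 * + x) (sym (nC0≡1 d))
  alternatingSum-partial d (suc K) = begin
    ∑ℤ (λ (a : Fin (suc (suc K))) → binomialWeight (suc d) (toℕ a))
      ≡⟨ ∑ℤ-snoc (suc K) (binomialWeight (suc d)) ⟩
    ∑ℤ (λ (a : Fin (suc K)) → binomialWeight (suc d) (toℕ a)) + - signℤ K * + (suc d C suc K)
      ≡⟨ cong₂ (λ x y → x + - signℤ K * y) (alternatingSum-partial d K)
               (trans (cong +_ (sym (nCk+nC[k+1]≡[n+1]C[k+1] d K))) (ℤP.pos-+ (d C K) (d C suc K))) ⟩
    signℤ K * + (d C K) + - signℤ K * (+ (d C K) + + (d C suc K))
      ≡⟨ telescope (signℤ K) (+ (d C K)) (+ (d C suc K)) ⟩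
    - signℤ K * + (d C suc K)
      ∎
    where
      telescope : ∀ (s x y : ℤ) → s * x + - s * (x + y) ≡ - s * y
      telescope = solve-∀

  alternatingSum : ∀ {d K} → d < K → ∑ℤ (λ (a : Fin K) → binomialWeight d (toℕ a)) ≡ δ₀ d
  alternatingSum {zero}  {suc K} _          = alternatingSum-0 K
  alternatingSum {suc d} {suc K} (s≤s d<K) = begin
    ∑ℤ (λ (a : Fin (suc K)) → binomialWeight (suc d) (toℕ a)) ≡⟨ alternatingSum-partial d K ⟩
    signℤ K * + (d C K)                                         ≡⟨ cong (λ x → signℤ K * + x) (k>n⇒nCk≡0 d<K) ⟩
    signℤ K * + 0                                               ≡⟨ ℤP.*-zeroʳ (signℤ K) ⟩
    + 0                                                         ∎

  binomialWeight-lower : ∀ d a →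
                         + a * binomialWeight d a ≡ + d * (binomialWeight d a - binomialWeight (d ∸ 1) a)
  binomialWeight-lower d a = begin
    + a * (signℤ a * + (d C a))                             ≡⟨ x*[y*z]≡y*[x*z] (+ a) (signℤ a) _ ⟩
    signℤ a * (+ a * + (d C a))                             ≡⟨ cong (signℤ a *_) absorption ⟩
    signℤ a * (+ d * + (d C a) - + d * + ((d ∸ 1) C a))     ≡⟨ swap-factors (signℤ a) (+ d) _ _ ⟩
    + d * (signℤ a * + (d C a) - signℤ a * + ((d ∸ 1) C a)) ∎
    where
      x*[y*z]≡y*[x*z] : ∀ (x y z : ℤ) → x * (y * z) ≡ y * (x * z)
      x*[y*z]≡y*[x*z] = solve-∀
      swap-factors : ∀ (s m x y : ℤ) → s * (m * x - m * y) ≡ m * (s * x - s * y)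
      swap-factors = solve-∀
      x≡[x+y]-y : ∀ (x y : ℤ) → x ≡ (x + y) - y
      x≡[x+y]-y = solve-∀
      lifted : + a * + (d C a) + + d * + ((d ∸ 1) C a) ≡ + d * + (d C a)
      lifted = begin
        + a * + (d C a) + + d * + ((d ∸ 1) C a)
          ≡⟨ cong₂ _+_ (ℤP.pos-* a (d C a)) (ℤP.pos-* d ((d ∸ 1) C a)) ⟨
        + (a Nat.* (d C a)) + + (d Nat.* ((d ∸ 1) C a))
          ≡⟨ ℤP.pos-+ (a Nat.* (d C a)) (d Nat.* ((d ∸ 1) C a)) ⟨
        + (a Nat.* (d C a) Nat.+ d Nat.* ((d ∸ 1) C a))
          ≡⟨ cong +_ (k*nCk+n*[n∸1]Ck≡n*nCk d a) ⟩
        + (d Nat.* (d C a))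
          ≡⟨ ℤP.pos-* d (d C a) ⟩
        + d * + (d C a)
          ∎
      absorption : + a * + (d C a) ≡ + d * + (d C a) - + d * + ((d ∸ 1) C a)
      absorption = trans (x≡[x+y]-y _ _) (cong (_- + d * + ((d ∸ 1) C a)) lifted)

  ∏-lowerAt : ∀ {n} (φ : Fin n → ℕ → ℤ) (i : Fin n) (d : Fin n → ℕ) →
              ∃[ r ] (∏ (λ k → φ k (d k)) ≡ φ i (d i) * r ×
                      ∏ (λ k → φ k (lowerAt i d k)) ≡ φ i (d i ∸ 1) * r)
  ∏-lowerAt = sum-lowerAt ℤP.*-1-commutativeMonoid

  signedFactorials-lowerAt : ∀ {n} (i : Fin n) d {p} → d i ≡ suc p →
                             signedFactorials d ≡ - (+ suc p * signedFactorials (lowerAt i d))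
  signedFactorials-lowerAt i d {p} dᵢ≡1+p with ∏-lowerAt (λ _ → signedFactorial) i d
  ... | r , ∏d≡ , ∏d′≡ rewrite dᵢ≡1+p = begin
    signedFactorials d                          ≡⟨ ∏d≡ ⟩
    signedFactorial (suc p) * r                 ≡⟨ cong (_* r) (signedFactorial-suc p) ⟩
    - (+ suc p * signedFactorial p) * r         ≡⟨ reassociate (+ suc p) (signedFactorial p) r ⟩
    - (+ suc p * (signedFactorial p * r))       ≡⟨ cong (λ x → - (+ suc p * x)) ∏d′≡ ⟨
    - (+ suc p * signedFactorials (lowerAt i d)) ∎
    where
      reassociate : ∀ (m s r : ℤ) → - (m * s) * r ≡ - (m * (s * r))
      reassociate = solve-∀

  weight : ∀ {n} → (Fin n → ℕ) → (Fin n → ℕ) → ℤ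
  weight d a = ∏ (λ k → binomialWeight (d k) (a k))

  weight-lowerAt : ∀ {n} (i : Fin n) d a → + a i * weight d a ≡ + d i * (weight d a - weight (lowerAt i d) a)
  weight-lowerAt i d a with ∏-lowerAt (λ k x → binomialWeight x (a k)) i d
  ... | r , ∏d≡ , ∏d′≡ = begin
    + a i * weight d a                            ≡⟨ cong (+ a i *_) ∏d≡ ⟩
    + a i * (w * r)                               ≡⟨ ℤP.*-assoc (+ a i) w r ⟨
    + a i * w * r                                 ≡⟨ cong (_* r) (binomialWeight-lower (d i) (a i)) ⟩
    + d i * (w - w′) * r                          ≡⟨ distribute (+ d i) w w′ r ⟩
    + d i * (w * r - w′ * r)                      ≡⟨ cong₂ (λ x y → + d i * (x - y)) ∏d≡ ∏d′≡ ⟨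
    + d i * (weight d a - weight (lowerAt i d) a) ∎
    where
      w w′ : ℤ
      w  = binomialWeight (d i) (a i)
      w′ = binomialWeight (d i ∸ 1) (a i)
      distribute : ∀ (m x y r : ℤ) → m * (x - y) * r ≡ m * (x * r - y * r)
      distribute = solve-∀

  ifPositive : ℕ → ℤ → ℤ
  ifPositive zero    _ = + 0
  ifPositive (suc _) x = x

  -- the coefficient of x^t in x_k · Π_{(i , j) ∈ es} (x_i - x_j)
  coeffTimesVar : ∀ {n} → List (Fin n × Fin n) → Fin n → (Fin n → ℕ) → ℤ
  coeffTimesVar es k t = ifPositive (t k) (coeffProd es (lowerAt k t))

  coeffProd-∷ : ∀ {n} (es : List (Fin n × Fin n)) i j t →
                coeffProd ((i , j) ∷ es) t ≡ coeffTimesVar es i t - coeffTimesVar es j t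
  coeffProd-∷ es i j t with t i | t j
  ... | zero  | zero  = refl
  ... | zero  | suc _ = refl
  ... | suc _ | zero  = refl
  ... | suc _ | suc _ = refl

  coeffProd-[] : ∀ {n} (t : Fin n → ℕ) → coeffProd [] t ≡ δ₀ (∑ t)
  coeffProd-[] t = begin
    (if and (map (λ k → t k ≡ᵇ 0) (allFin _)) then + 1 else + 0)
      ≡⟨ cong (if_then + 1 else + 0) (foldr-map-allFin _∧_ true (λ k → t k ≡ᵇ 0)) ⟩
    (if Vector.foldr _∧_ true (λ k → t k ≡ᵇ 0) then + 1 else + 0)
      ≡⟨ cong (if_then + 1 else + 0) (foldr-homomorphic (_≡ᵇ 0) refl ≡ᵇ0-+ t) ⟨
    (if ∑ t ≡ᵇ 0 then + 1 else + 0)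
      ≡⟨ if-≡ᵇ0 (∑ t) ⟩
    δ₀ (∑ t)
      ∎
    where
      ≡ᵇ0-+ : ∀ m n → (m Nat.+ n ≡ᵇ 0) ≡ (m ≡ᵇ 0) ∧ (n ≡ᵇ 0)
      ≡ᵇ0-+ zero    n = refl
      ≡ᵇ0-+ (suc m) n = refl
      if-≡ᵇ0 : ∀ m → (if m ≡ᵇ 0 then + 1 else + 0) ≡ δ₀ m
      if-≡ᵇ0 zero    = refl
      if-≡ᵇ0 (suc m) = refl

  coeffProd-homogeneous : ∀ {n} (es : List (Fin n × Fin n)) t → ∑ t ≢ length es → coeffProd es t ≡ + 0
  coeffProd-homogeneous [] t ∑t≢0 with ∑ t in ∑t≡
  ... | zero  = ⊥-elim (∑t≢0 refl)
  ... | suc _ = trans (coeffProd-[] t) (cong δ₀ ∑t≡)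
  coeffProd-homogeneous ((i , j) ∷ es) t ∑t≢ =
    trans (coeffProd-∷ es i j t) (cong₂ _-_ (vanishes i) (vanishes j))
    where
      vanishes : ∀ k → ifPositive (t k) (coeffProd es (lowerAt k t)) ≡ + 0
      vanishes k with t k in tₖ≡
      ... | zero  = refl
      ... | suc _ = coeffProd-homogeneous es (lowerAt k t) (∑t≢ ∘ trans (∑-lowerAt k t tₖ≡) ∘ cong suc)

  coeffProd-cong : ∀ {n} (es : List (Fin n × Fin n)) {t u} → t ≗ u → coeffProd es t ≡ coeffProd es u
  coeffProd-cong [] {t} {u} t≗u =
    trans (coeffProd-[] t) (trans (cong δ₀ (∑-cong t≗u)) (sym (coeffProd-[] u)))
  coeffProd-cong ((i , j) ∷ es) {t} {u} t≗u =
    trans (coeffProd-∷ es i j t)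
          (trans (cong₂ _-_ (timesVar-cong i) (timesVar-cong j)) (sym (coeffProd-∷ es i j u)))
    where
      timesVar-cong : ∀ k → coeffTimesVar es k t ≡ coeffTimesVar es k u
      timesVar-cong k = cong₂ ifPositive (t≗u k) (coeffProd-cong es (lowerAt-cong k t≗u))

  evalEdges : ∀ {n} → List (Fin n × Fin n) → (Fin n → ℕ) → ℤ
  evalEdges es a = prodℤ es (λ { (i , j) → + a i - + a j })

  coloringSum : ∀ {n} K → (Fin n → ℕ) → List (Fin n × Fin n) → ℤ
  coloringSum {n} K d es = sumℤ (allFuns n K) (λ c → weight d (toℕ ∘ c) * evalEdges es (toℕ ∘ c))

  coloringSum-[] : ∀ {n K} (d : Fin n → ℕ) → (∀ k → d k < K) →
                   coloringSum K d [] ≡ signedFactorials d * coeffProd [] d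
  coloringSum-[] {n} {K} d d<K = begin
    sumℤ (allFuns n K) (λ c → weight d (toℕ ∘ c) * + 1)
      ≡⟨ sumℤ-cong (allFuns n K) (λ c → ℤP.*-identityʳ (weight d (toℕ ∘ c))) ⟩
    sumℤ (allFuns n K) (λ c → ∏ (λ k → binomialWeight (d k) (toℕ (c k))))
      ≡⟨ sumℤ-allFuns n K (λ k a → binomialWeight (d k) (toℕ a)) ⟩
    ∏ (λ k → sumℤ (allFin K) (λ a → binomialWeight (d k) (toℕ a)))
      ≡⟨ ∏-cong (λ k → trans (sumℤ-allFin {K} _) (alternatingSum (d<K k))) ⟩
    ∏ (δ₀ ∘ d)
      ≡⟨ ∏-cong (δ₀≡signedFactorial*δ₀ ∘ d) ⟩
    ∏ (λ k → signedFactorial (d k) * δ₀ (d k))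
      ≡⟨ ∏-distrib-* (signedFactorial ∘ d) (δ₀ ∘ d) ⟩
    signedFactorials d * ∏ (δ₀ ∘ d)
      ≡⟨ cong (signedFactorials d *_) (trans (sym (δ₀-∑ d)) (sym (coeffProd-[] d))) ⟩
    signedFactorials d * coeffProd [] d
      ∎

  coloringSum-∷ : ∀ {n} K d (i j : Fin n) es →
                  coloringSum K d ((i , j) ∷ es) ≡
                  + d i * (coloringSum K d es - coloringSum K (lowerAt i d) es)
                  - + d j * (coloringSum K d es - coloringSum K (lowerAt j d) es)
  coloringSum-∷ {n} K d i j es = begin
    sumℤ cs (λ c → weight d (toℕ ∘ c) * ((+ toℕ (c i) - + toℕ (c j)) * evalEdges es (toℕ ∘ c)))
      ≡⟨ sumℤ-cong cs expand ⟩
    sumℤ cs (λ c → + d i * (S d c - S dⁱ c) - + d j * (S d c - S dʲ c))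
      ≡⟨ sumℤ-distrib-minus cs (λ c → + d i * (S d c - S dⁱ c)) (λ c → + d j * (S d c - S dʲ c)) ⟩
    sumℤ cs (λ c → + d i * (S d c - S dⁱ c)) - sumℤ cs (λ c → + d j * (S d c - S dʲ c))
      ≡⟨ cong₂ _-_ (linear (d i) dⁱ) (linear (d j) dʲ) ⟩
    + d i * (coloringSum K d es - coloringSum K dⁱ es) - + d j * (coloringSum K d es - coloringSum K dʲ es)
      ∎
    where
      cs : List (Fin n → Fin K)
      cs = allFuns n K
      dⁱ dʲ : Fin n → ℕ
      dⁱ = lowerAt i d
      dʲ = lowerAt j d
      S : (Fin n → ℕ) → (Fin n → Fin K) → ℤ
      S d′ c = weight d′ (toℕ ∘ c) * evalEdges es (toℕ ∘ c)
      linear : ∀ m d′ → sumℤ cs (λ c → + m * (S d c - S d′ c)) ≡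
                        + m * (coloringSum K d es - coloringSum K d′ es)
      linear m d′ = trans (sumℤ-*ˡ cs (+ m) _) (cong (+ m *_) (sumℤ-distrib-minus cs (S d) (S d′)))
      regroup₁ : ∀ (w x y e : ℤ) → w * ((x - y) * e) ≡ (x * w - y * w) * e
      regroup₁ = solve-∀
      regroup₂ : ∀ (p w wⁱ q wʲ e : ℤ) →
                 (p * (w - wⁱ) - q * (w - wʲ)) * e ≡ p * (w * e - wⁱ * e) - q * (w * e - wʲ * e)
      regroup₂ = solve-∀
      expand : ∀ c → weight d (toℕ ∘ c) * ((+ toℕ (c i) - + toℕ (c j)) * evalEdges es (toℕ ∘ c))
                     ≡ + d i * (S d c - S dⁱ c) - + d j * (S d c - S dʲ c)
      expand c = begin
        W * ((+ a i - + a j) * E)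
          ≡⟨ regroup₁ W (+ a i) (+ a j) E ⟩
        (+ a i * W - + a j * W) * E
          ≡⟨ cong₂ (λ x y → (x - y) * E) (weight-lowerAt i d a) (weight-lowerAt j d a) ⟩
        (+ d i * (W - weight dⁱ a) - + d j * (W - weight dʲ a)) * E
          ≡⟨ regroup₂ (+ d i) W (weight dⁱ a) (+ d j) (weight dʲ a) E ⟩
        + d i * (S d c - S dⁱ c) - + d j * (S d c - S dʲ c)
          ∎
        where
          a : Fin n → ℕ
          a = toℕ ∘ c
          W E : ℤ
          W = weight d a
          E = evalEdges es a

  coefficientFormula : ∀ {n K} (es : List (Fin n × Fin n)) (d : Fin n → ℕ) →
                       (∀ k → d k < K) → length es ≤ ∑ d →
                       coloringSum K d es ≡ signedFactorials d * coeffProd es d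
  coefficientFormula []             d d<K _   = coloringSum-[] d d<K
  coefficientFormula {K = K} ((i , j) ∷ es) d d<K |es|<∑d = begin
    coloringSum K d ((i , j) ∷ es)            ≡⟨ coloringSum-∷ K d i j es ⟩
    + d i * (S - Sⁱ) - + d j * (S - Sʲ)        ≡⟨ cong (λ x → + d i * (x - Sⁱ) - + d j * (x - Sʲ)) S≡0 ⟩
    + d i * (+ 0 - Sⁱ) - + d j * (+ 0 - Sʲ)    ≡⟨ cancel-zeros (+ d i) (+ d j) Sⁱ Sʲ ⟩
    - (+ d i * Sⁱ) - - (+ d j * Sʲ)            ≡⟨ cong₂ _-_ (lowered i) (lowered j) ⟩
    ν * cⁱ - ν * cʲ                            ≡⟨ factor ν cⁱ cʲ ⟨
    ν * (cⁱ - cʲ)                              ≡⟨ cong (ν *_) (coeffProd-∷ es i j d) ⟨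
    ν * coeffProd ((i , j) ∷ es) d             ∎
    where
      ν S Sⁱ Sʲ cⁱ cʲ : ℤ
      ν  = signedFactorials d
      cⁱ = coeffTimesVar es i d
      cʲ = coeffTimesVar es j d
      S  = coloringSum K d es
      Sⁱ = coloringSum K (lowerAt i d) es
      Sʲ = coloringSum K (lowerAt j d) es
      cancel-zeros : ∀ (p q x y : ℤ) → p * (+ 0 - x) - q * (+ 0 - y) ≡ - (p * x) - - (q * y)
      cancel-zeros = solve-∀
      factor : ∀ (s x y : ℤ) → s * (x - y) ≡ s * x - s * y
      factor = solve-∀
      -- es has fewer than Σ d factors, so x^d does not occur in their product
      S≡0 : S ≡ + 0
      S≡0 = begin
        S                     ≡⟨ coefficientFormula es d d<K (ℕP.<⇒≤ |es|<∑d) ⟩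
        ν * coeffProd es d    ≡⟨ cong (ν *_) (coeffProd-homogeneous es d (ℕP.<⇒≢ |es|<∑d ∘ sym)) ⟩
        ν * + 0               ≡⟨ ℤP.*-zeroʳ ν ⟩
        + 0                   ∎
      lowered : ∀ k → - (+ d k * coloringSum K (lowerAt k d) es) ≡
                      ν * ifPositive (d k) (coeffProd es (lowerAt k d))
      lowered k with d k in dₖ≡
      ... | zero  = trans (cong -_ (ℤP.*-zeroˡ (coloringSum K (lowerAt k d) es))) (sym (ℤP.*-zeroʳ ν))
      ... | suc p = begin
        - (+ suc p * coloringSum K d′ es)
          ≡⟨ cong (λ x → - (+ suc p * x)) (coefficientFormula es d′ d′<K |es|≤∑d′) ⟩
        - (+ suc p * (signedFactorials d′ * coeffProd es d′))
          ≡⟨ reassociate (+ suc p) (signedFactorials d′) (coeffProd es d′) ⟩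
        - (+ suc p * signedFactorials d′) * coeffProd es d′
          ≡⟨ cong (_* coeffProd es d′) (signedFactorials-lowerAt k d dₖ≡) ⟨
        ν * coeffProd es d′
          ∎
        where
          d′ : Fin _ → ℕ
          d′ = lowerAt k d
          d′<K : ∀ k′ → d′ k′ < K
          d′<K k′ = ℕP.≤-<-trans (lowerAt-≤ k d k′) (d<K k′)
          |es|≤∑d′ : length es ≤ ∑ d′
          |es|≤∑d′ = ℕP.≤-pred (subst (suc (length es) ≤_) (∑-lowerAt k d dₖ≡) |es|<∑d)
          reassociate : ∀ (m s c : ℤ) → - (m * (s * c)) ≡ - (m * s) * c
          reassociate = solve-∀

  signedBinomials≡weight : ∀ {n} (d a : Fin n → ℕ) →
                           signℤ (sumV a) * prodℤ (allFin n) (λ i → + (d i C a i)) ≡ weight d a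
  signedBinomials≡weight {n} d a = begin
    signℤ (sumV a) * prodℤ (allFin n) binomials
      ≡⟨ cong₂ _*_ (cong signℤ (sumV≡∑ a)) (prodℤ-allFin binomials) ⟩
    signℤ (∑ a) * ∏ binomials
      ≡⟨ cong (_* ∏ binomials) (foldr-homomorphic signℤ refl signℤ-+ a) ⟩
    ∏ (signℤ ∘ a) * ∏ binomials
      ≡⟨ ∏-distrib-* (signℤ ∘ a) binomials ⟨
    weight d a
      ∎
    where
      binomials : Fin n → ℤ
      binomials i = + (d i C a i)

  not-≡ᵇ⇒≡ : ∀ m n → not (m ≡ᵇ n) ≡ false → m ≡ n
  not-≡ᵇ⇒≡ m n eq = ℕP.≡ᵇ⇒≡ m n (subst T (sym (not-injective {y = true} eq)) tt)

  evalPG-improper : ∀ {n K} (G : Graph n) (c : Fin n → Fin K) →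
                    isProper G c ≡ false → evalPG G (toℕ ∘ c) ≡ + 0
  evalPG-improper {n} G c = prodℤ-vanishing differentColors (edges G) difference difference≡0
    where
      differentColors : Fin n × Fin n → Bool
      differentColors (i , j) = not (toℕ (c i) ≡ᵇ toℕ (c j))
      difference : Fin n × Fin n → ℤ
      difference (i , j) = + toℕ (c i) - + toℕ (c j)
      difference≡0 : ∀ e → differentColors e ≡ false → difference e ≡ + 0
      difference≡0 (i , j) eq = ℤP.i≡j⇒i-j≡0 (cong +_ (not-≡ᵇ⇒≡ (toℕ (c i)) (toℕ (c j)) eq))

  colorSum≡coloringSum : ∀ {n} (G : Graph n) f →
                         colorSum G f ≡ coloringSum (suc (maxDeg f)) (λ i → f i ∸ 1) (edges G)
  colorSum≡coloringSum {n} G f =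
    trans (sumℤ-filter (isProper G) cs term improper⇒term≡0)
          (sumℤ-cong cs λ c → cong (_* evalPG G (toℕ ∘ c)) (signedBinomials≡weight d (toℕ ∘ c)))
    where
      d : Fin n → ℕ
      d i = f i ∸ 1
      cs : List (Fin n → Fin (suc (maxDeg f)))
      cs = allFuns n (suc (maxDeg f))
      signedBinomials term : (Fin n → Fin (suc (maxDeg f))) → ℤ
      signedBinomials c = signℤ (sumV (toℕ ∘ c)) * prodℤ (allFin n) (λ i → + (d i C toℕ (c i)))
      term c = signedBinomials c * evalPG G (toℕ ∘ c)
      improper⇒term≡0 : ∀ c → isProper G c ≡ false → term c ≡ + 0
      improper⇒term≡0 c improper =
        trans (cong (signedBinomials c *_) (evalPG-improper G c improper)) (ℤP.*-zeroʳ (signedBinomials c))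

  colorSum-formula : ∀ {n} (G : Graph n) f → numEdges G ≤ ∑ (λ i → f i ∸ 1) →
                     colorSum G f ≡ signedFactorials (λ i → f i ∸ 1) * coeffPG G (λ i → f i ∸ 1)
  colorSum-formula G f |E|≤∑d =
    trans (colorSum≡coloringSum G f) (coefficientFormula (edges G) (λ i → f i ∸ 1) d<K |E|≤∑d)
    where
      d<K : ∀ k → f k ∸ 1 < suc (maxDeg f)
      d<K k = s≤s (≤-foldr-⊔ (λ i → f i ∸ 1) (∈-allFin k))

  coeffPG≢0⇔colorSum≢0 : ∀ {n} (G : Graph n) f → numEdges G ≤ ∑ (λ i → f i ∸ 1) →
                         (coeffPG G (λ i → f i ∸ 1) ≢ + 0) ⇔ (colorSum G f ≢ + 0)
  coeffPG≢0⇔colorSum≢0 {n} G f |E|≤∑d = mk⇔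
    (λ coeff≢0 → subst (_≢ + 0) (sym formula) (*-≢0 (signedFactorials≢0 d) coeff≢0))
    (λ colorSum≢0 coeff≡0 → colorSum≢0 (trans formula (trans (cong (ν *_) coeff≡0) (ℤP.*-zeroʳ ν))))
    where
      d : Fin n → ℕ
      d i = f i ∸ 1
      ν : ℤ
      ν = signedFactorials d
      formula : colorSum G f ≡ ν * coeffPG G d
      formula = colorSum-formula G f |E|≤∑d

  AT⇔coeffPG≢0 : ∀ {n} (G : Graph n) f → ∑ (λ i → f i ∸ 1) ≡ numEdges G →
                 AT G f ⇔ (coeffPG G (λ i → f i ∸ 1) ≢ + 0)
  AT⇔coeffPG≢0 G f ∑d≡|E| = mk⇔
    (λ (t , t≤d , coeff≢0) → coeff≢0 ∘ trans (coeffPG-top t≤d coeff≢0))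
    (λ coeff≢0 → _ , (λ _ → ℕP.≤-refl) , coeff≢0)
    where
      degree : ∀ t → coeffPG G t ≢ + 0 → ∑ t ≡ numEdges G
      degree t coeff≢0 =
        decidable-stable (∑ t ℕP.≟ numEdges G) (coeff≢0 ∘ coeffProd-homogeneous (edges G) t)
      coeffPG-top : ∀ {t} → (∀ i → t i ≤ f i ∸ 1) → coeffPG G t ≢ + 0 →
                    coeffPG G t ≡ coeffPG G (λ i → f i ∸ 1)
      coeffPG-top {t} t≤d coeff≢0 =
        coeffProd-cong (edges G) (≤∧∑≡⇒≗ t≤d (trans (degree t coeff≢0) (sym ∑d≡|E|)))

open CoefficientFormula
open import Data.Nat using (_+_)

theorem1p7 : (n : ℕ) (G : Graph n) (f : Fin n → ℕ) →
    ((i : Fin n) → f i ≥ 1) →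
    sumV f ≡ numEdges G + n →
    AT G f ⇔ (colorSum G f ≢ + 0)
theorem1p7 n G f f≥1 sumVf≡m+n =
  coeffPG≢0⇔colorSum≢0 G f (ℕP.≤-reflexive (sym ∑d≡m)) ⇔-∘ AT⇔coeffPG≢0 G f ∑d≡m
  where
    ∑d≡m : ∑ (λ i → f i ∸ 1) ≡ numEdges G
    ∑d≡m = ℕP.+-cancelʳ-≡ n _ _ (trans (sym (∑-pred f f≥1)) (trans (sym (sumV≡∑ f)) sumVf≡m+n))
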